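{- Let $f:\{0,1\}^n\to\{0,1\}$ with $N=|f^{ -1}(1)|\ge1$. If $\mathrm{reldist}(f,\mathsf{Unate})>\varepsilon$, then for every vector $d\in\{0,1\}^n$, $$\sum_{i\in[n]}\big|\mathsf{Edge}_i^{1-d_i}(f)\big|\ge\frac{\varepsilon N}{8}.$$
   Context: $f$ is unate if for each $i\in[n]$ it is monotone non-decreasing or monotone non-increasing in the $i$-th variable; $\mathsf{Unate}$ is the class of unate functions on $\{0,1\}^n$. $\mathrm{reldist}(f,g)=|f^{ -1}(1)\triangle g^{ -1}(1)|/|f^{ -1}(1)|$ and $\mathrm{reldist}(f,\mathsf{Unate})=\min_{g\in\mathsf{Unate}}\mathrm{reldist}(f,g)$. For $x\in\{0,1\}^n$, $x^{(i)}$ is $x$ with the $i$-th bit flipped. $\mathsf{Edge}_i^1(f)$ is the set of pairs $\{x,x^{(i)}\}$ with $x_i=0$, $f(x)=0$, $f(x^{(i)})=1$; $\mathsf{Edge}_i^0(f)$ is the set of pairs with $x_i=0$, $f(x)=1$, $f(x^{(i)})=0$.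
   Formalization: The parameter ε ranges over the rationals. -}

module Defs where

open import Data.Bool using (Bool; true; false; not; _xor_; if_then_else_; _∧_) renaming (_≤_ to _≤ᵇ_)
open import Data.Nat using (ℕ; zero; suc; _+_; _≤_; NonZero; >-nonZero)
open import Data.Fin using (Fin)
open import Data.Vec using (Vec; []; _∷_; lookup; updateAt)
open import Data.List using (List; []; _∷_; map; _++_; allFin)
open import Data.Nat.ListAction using (sum)
open import Data.Sum using (_⊎_)
open import Data.Integer using (+_)
open import Data.Rational using (ℚ; _/_)
open import Relation.Binary.PropositionalEquality using (_≡_)

-- points of the hypercube {0,1}^n  (false = 0, true = 1)
Cube : ℕ → Set
Cube n = Vec Bool n

allPoints : (n : ℕ) → List (Cube n)
allPoints zero = [] ∷ []
allPoints (suc n) = map (false ∷_) (allPoints n) ++ map (true ∷_) (allPoints n)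

count : {A : Set} → (A → Bool) → List A → ℕ
count p [] = 0
count p (x ∷ xs) = (if p x then 1 else 0) + count p xs

flipAt : {n : ℕ} → Cube n → Fin n → Cube n
flipAt x i = updateAt x i not

Unate : {n : ℕ} → (Cube n → Bool) → Set
Unate {n} f = (i : Fin n) →
  ((x : Cube n) → lookup x i ≡ false → f x ≤ᵇ f (flipAt x i))
  ⊎ ((x : Cube n) → lookup x i ≡ false → f (flipAt x i) ≤ᵇ f x)

ones : {n : ℕ} → (Cube n → Bool) → ℕ
ones {n} f = count f (allPoints n)

symDiff : {n : ℕ} → (Cube n → Bool) → (Cube n → Bool) → ℕ
symDiff {n} f g = count (λ x → f x xor g x) (allPoints n)

reldist : {n : ℕ} → (f g : Cube n → Bool) → 1 ≤ ones f → ℚ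
reldist f g h = (+ symDiff f g) / ones f
  where instance _ = >-nonZero h

-- |Edge_i^b(f)|: pairs {x, x^{(i)}} with x_i = 0,
--   b = true  (Edge^1): f(x) = 0, f(x^{(i)}) = 1
--   b = false (Edge^0): f(x) = 1, f(x^{(i)}) = 0
-- (each pair counted once, via its endpoint x with x_i = 0)
edgeCount : {n : ℕ} → Bool → (Cube n → Bool) → Fin n → ℕ
edgeCount {n} b f i = count p (allPoints n)
  where
  isZero : Bool → Bool
  isZero false = true
  isZero true = false
  eqB : Bool → Bool → Bool
  eqB true true = true
  eqB false false = true
  eqB _ _ = false
  p : Cube n → Bool
  p x = isZero (lookup x i) ∧ eqB (f x) (not b) ∧ eqB (f (flipAt x i)) b

edgeSumAgainst : {n : ℕ} → (Cube n → Bool) → Vec Bool n → ℕ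
edgeSumAgainst {n} f d = sum (map (λ i → edgeCount (not (lookup d i)) f i) (allFin n))

-- Sort f along d recursively: sort its faces x₀ = 0 and x₀ = 1 along the
-- remaining directions, then sort every line {(0,y),(1,y)} in direction d₀.
-- The result g is monotone in each direction dᵢ, hence unate. Sorting a line
-- never moves it away from the values of f on it, except by at most 2 when f
-- has an edge against d₀ there; so |f △ g| ≤ 2 Σᵢ |Edgeᵢ^{1-dᵢ}(f)|, and
-- ε N < |f △ g| gives the bound.
module Submission where

open import Defs

module Sorting where

  open import Data.Bool as Bool
    using (Bool; true; false; not; _∧_; _∨_; _xor_; if_then_else_; b≤b)
  open import Data.Bool.Properties as BoolP using (≤-minimum; ≤-maximum)
  open import Data.Nat as ℕ using (ℕ; zero; suc; _+_; _*_; z≤n; _≤?_)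
  open import Data.Nat.Properties as ℕP using (+-assoc; +-comm; +-identityʳ; +-mono-≤)
  open import Data.Nat.ListAction using (sum)
  open import Algebra.Properties.CommutativeSemigroup ℕP.+-commutativeSemigroup
    using () renaming (interchange to +-interchange)
  open import Data.Fin using (Fin; zero; suc)
  open import Data.Vec using (Vec; []; _∷_; lookup)
  open import Data.List using (List; []; _∷_; map; _++_; allFin)
  open import Data.List.Properties using (map-cong; map-tabulate)
  open import Data.Sum using (inj₁; inj₂)
  open import Function using (_∘_; id)
  open import Relation.Nullary.Decidable using (True; toWitness)
  open import Relation.Binary.PropositionalEquality
    using (_≡_; refl; sym; trans; cong; cong₂; module ≡-Reasoning)

  indicator : Bool → ℕ
  indicator b = if b then 1 else 0

  module _ {A : Set} where

    count-++ : (p : A → Bool) (xs ys : List A) → count p (xs ++ ys) ≡ count p xs + count p ys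
    count-++ p []       ys = refl
    count-++ p (x ∷ xs) ys = trans (cong (indicator (p x) +_) (count-++ p xs ys))
                                   (sym (+-assoc (indicator (p x)) _ _))

    count-map : {B : Set} (p : B → Bool) (h : A → B) (xs : List A) →
                count p (map h xs) ≡ count (p ∘ h) xs
    count-map p h []       = refl
    count-map p h (x ∷ xs) = cong (indicator (p (h x)) +_) (count-map p h xs)

    count-cong : {p q : A → Bool} → (∀ x → p x ≡ q x) → (xs : List A) → count p xs ≡ count q xs
    count-cong p≗q []       = refl
    count-cong p≗q (x ∷ xs) = cong₂ _+_ (cong indicator (p≗q x)) (count-cong p≗q xs)

    count-const-false : (xs : List A) → count (λ _ → false) xs ≡ 0
    count-const-false []       = refl
    count-const-false (_ ∷ xs) = count-const-false xs

    count≡sum-indicator : (p : A → Bool) (xs : List A) → count p xs ≡ sum (map (indicator ∘ p) xs)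
    count≡sum-indicator p []       = refl
    count≡sum-indicator p (x ∷ xs) = cong (indicator (p x) +_) (count≡sum-indicator p xs)

    sum-map-+ : (h k : A → ℕ) (xs : List A) →
                sum (map (λ x → h x + k x) xs) ≡ sum (map h xs) + sum (map k xs)
    sum-map-+ h k []       = refl
    sum-map-+ h k (x ∷ xs) = begin
      (h x + k x) + sum (map (λ x → h x + k x) xs)   ≡⟨ cong ((h x + k x) +_) (sum-map-+ h k xs) ⟩
      (h x + k x) + (sum (map h xs) + sum (map k xs)) ≡⟨ +-interchange (h x) (k x) _ _ ⟩
      (h x + sum (map h xs)) + (k x + sum (map k xs)) ∎
      where open ≡-Reasoning

    sum-map-*ˡ : (m : ℕ) (h : A → ℕ) (xs : List A) → sum (map (λ x → m * h x) xs) ≡ m * sum (map h xs)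
    sum-map-*ˡ m h []       = sym (ℕP.*-zeroʳ m)
    sum-map-*ˡ m h (x ∷ xs) = trans (cong (m * h x +_) (sum-map-*ˡ m h xs))
                                    (sym (ℕP.*-distribˡ-+ m (h x) _))

    sum-map-mono : {h k : A → ℕ} → (∀ x → h x ℕ.≤ k x) → (xs : List A) →
                   sum (map h xs) ℕ.≤ sum (map k xs)
    sum-map-mono h≤k []       = z≤n
    sum-map-mono h≤k (x ∷ xs) = +-mono-≤ (h≤k x) (sum-map-mono h≤k xs)

  sum-allFin-suc : {n : ℕ} (h : Fin (suc n) → ℕ) →
                   sum (map h (allFin (suc n))) ≡ h zero + sum (map (h ∘ suc) (allFin n))
  sum-allFin-suc h = cong (λ hs → h zero + sum hs)
    (trans (map-tabulate suc h) (sym (map-tabulate id (h ∘ suc))))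

  face : {n : ℕ} → (Cube (suc n) → Bool) → Bool → Cube n → Bool
  face f c y = f (c ∷ y)

  count-allPoints-suc : {n : ℕ} (p : Cube (suc n) → Bool) →
    count p (allPoints (suc n)) ≡ count (face p false) (allPoints n) + count (face p true) (allPoints n)
  count-allPoints-suc {n} p = trans (count-++ p (map (false ∷_) (allPoints n)) _)
    (cong₂ _+_ (count-map p (false ∷_) (allPoints n)) (count-map p (true ∷_) (allPoints n)))

  symDiff-faces : {n : ℕ} (f g : Cube (suc n) → Bool) →
    symDiff f g ≡ symDiff (face f false) (face g false) + symDiff (face f true) (face g true)
  symDiff-faces f g = count-allPoints-suc (λ x → f x xor g x)

  -- edgeOfType b (f x) (f x⁽ⁱ⁾) says that {x, x⁽ⁱ⁾} lies in Edgeᵢᵇ(f).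
  edgeOfType : Bool → Bool → Bool → Bool
  edgeOfType true  false true  = true
  edgeOfType false true  false = true
  edgeOfType _     _     _     = false

  edgeAt : {n : ℕ} → Bool → (Cube n → Bool) → Fin n → Cube n → Bool
  edgeAt b f i x = not (lookup x i) ∧ edgeOfType b (f x) (f (flipAt x i))

  -- The predicate counted by edgeCount is local to its where block; unifying
  -- edgeCount b f i with count ?p (allPoints n) gives it a name.
  countedPredicate : {n k : ℕ} {p : Cube n → Bool} → count p (allPoints n) ≡ k → Cube n → Bool
  countedPredicate {p = p} _ = p

  edgePredicate : {n : ℕ} → Bool → (Cube n → Bool) → Fin n → Cube n → Bool
  edgePredicate b f i = countedPredicate {k = edgeCount b f i} refl

  edgePredicate≗edgeAt : {n : ℕ} (b : Bool) (f : Cube n → Bool) (i : Fin n) (x : Cube n) →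
                         edgePredicate b f i x ≡ edgeAt b f i x
  edgePredicate≗edgeAt b f i x with lookup x i | f x | f (flipAt x i) | b
  ... | true  | _     | _     | _     = refl
  ... | false | false | false | false = refl
  ... | false | false | false | true  = refl
  ... | false | false | true  | false = refl
  ... | false | false | true  | true  = refl
  ... | false | true  | false | false = refl
  ... | false | true  | false | true  = refl
  ... | false | true  | true  | false = refl
  ... | false | true  | true  | true  = refl

  edgeCount≡count-edgeAt : {n : ℕ} (b : Bool) (f : Cube n → Bool) (i : Fin n) →
                           edgeCount b f i ≡ count (edgeAt b f i) (allPoints n)
  edgeCount≡count-edgeAt {n} b f i = count-cong (edgePredicate≗edgeAt b f i) (allPoints n)

  edgeCount-zero : {n : ℕ} (b : Bool) (f : Cube (suc n) → Bool) →
    edgeCount b f zero ≡ count (λ y → edgeOfType b (face f false y) (face f true y)) (allPoints n)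
  edgeCount-zero {n} b f = begin
    edgeCount b f zero                                   ≡⟨ edgeCount≡count-edgeAt b f zero ⟩
    count (edgeAt b f zero) (allPoints (suc n))          ≡⟨ count-allPoints-suc (edgeAt b f zero) ⟩
    count (face (edgeAt b f zero) false) (allPoints n) + count (λ _ → false) (allPoints n)
      ≡⟨ cong (count (face (edgeAt b f zero) false) (allPoints n) +_) (count-const-false (allPoints n)) ⟩
    count (face (edgeAt b f zero) false) (allPoints n) + 0 ≡⟨ +-identityʳ _ ⟩
    count (λ y → edgeOfType b (face f false y) (face f true y)) (allPoints n) ∎
    where open ≡-Reasoning

  edgeCount-suc : {n : ℕ} (b : Bool) (f : Cube (suc n) → Bool) (i : Fin n) →
    edgeCount b f (suc i) ≡ edgeCount b (face f false) i + edgeCount b (face f true) i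
  edgeCount-suc b f i = trans (edgeCount≡count-edgeAt b f (suc i))
    (trans (count-allPoints-suc (edgeAt b f (suc i)))
           (sym (cong₂ _+_ (edgeCount≡count-edgeAt b (face f false) i)
                           (edgeCount≡count-edgeAt b (face f true) i))))

  edgeSumAgainst-∷ : {n : ℕ} (f : Cube (suc n) → Bool) (b : Bool) (d : Vec Bool n) →
    edgeSumAgainst f (b ∷ d) ≡
    edgeCount (not b) f zero + (edgeSumAgainst (face f false) d + edgeSumAgainst (face f true) d)
  edgeSumAgainst-∷ {n} f b d = begin
    edgeSumAgainst f (b ∷ d)  ≡⟨ sum-allFin-suc (λ i → edgeCount (not (lookup (b ∷ d) i)) f i) ⟩
    edgeCount (not b) f zero + sum (map (λ i → edgeCount (not (lookup d i)) f (suc i)) (allFin n))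
      ≡⟨ cong (λ s → edgeCount (not b) f zero + sum s)
              (map-cong (λ i → edgeCount-suc (not (lookup d i)) f i) (allFin n)) ⟩
    edgeCount (not b) f zero + sum (map (λ i → against (face f false) i + against (face f true) i) (allFin n))
      ≡⟨ cong (edgeCount (not b) f zero +_) (sum-map-+ _ _ (allFin n)) ⟩
    edgeCount (not b) f zero + (edgeSumAgainst (face f false) d + edgeSumAgainst (face f true) d) ∎
    where
    open ≡-Reasoning
    against : (Cube n → Bool) → Fin n → ℕ
    against g i = edgeCount (not (lookup d i)) g i

  infix 4 _≤[_]_

  _≤[_]_ : Bool → Bool → Bool → Set
  u ≤[ true  ] v = u Bool.≤ v
  u ≤[ false ] v = v Bool.≤ u

  MonotoneAlong : {n : ℕ} → Vec Bool n → (Cube n → Bool) → Set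
  MonotoneAlong {n} d g = (i : Fin n) (x : Cube n) → lookup x i ≡ false → g x ≤[ lookup d i ] g (flipAt x i)

  MonotoneAlong⇒Unate : {n : ℕ} (d : Vec Bool n) (g : Cube n → Bool) → MonotoneAlong d g → Unate g
  MonotoneAlong⇒Unate d g mono i with lookup d i | mono i
  ... | true  | monoᵢ = inj₁ monoᵢ
  ... | false | monoᵢ = inj₂ monoᵢ

  ∧-mono-≤ : {u u′ v v′ : Bool} → u Bool.≤ u′ → v Bool.≤ v′ → u ∧ v Bool.≤ u′ ∧ v′
  ∧-mono-≤ {false} _   _    = ≤-minimum _
  ∧-mono-≤ {true}  b≤b v≤v′ = v≤v′

  ∨-mono-≤ : {u u′ v v′ : Bool} → u Bool.≤ u′ → v Bool.≤ v′ → u ∨ v Bool.≤ u′ ∨ v′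
  ∨-mono-≤ {true}          b≤b _    = b≤b
  ∨-mono-≤ {false} {false} _   v≤v′ = v≤v′
  ∨-mono-≤ {false} {true}  _   _    = ≤-maximum _

  ∧≤∨ : (u v : Bool) → u ∧ v Bool.≤ u ∨ v
  ∧≤∨ false v = ≤-minimum v
  ∧≤∨ true  v = ≤-maximum v

  ∧-mono-≤[_] : (t : Bool) {u u′ v v′ : Bool} → u ≤[ t ] u′ → v ≤[ t ] v′ → u ∧ v ≤[ t ] u′ ∧ v′
  ∧-mono-≤[ true  ] = ∧-mono-≤
  ∧-mono-≤[ false ] = ∧-mono-≤

  ∨-mono-≤[_] : (t : Bool) {u u′ v v′ : Bool} → u ≤[ t ] u′ → v ≤[ t ] v′ → u ∨ v ≤[ t ] u′ ∨ v′
  ∨-mono-≤[ true  ] = ∨-mono-≤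
  ∨-mono-≤[ false ] = ∨-mono-≤

  -- sortPair b c g₀ g₁ is the value at c of the pair (g₀, g₁) sorted in direction b.
  sortPair : Bool → Bool → Bool → Bool → Bool
  sortPair true  false g₀ g₁ = g₀ ∧ g₁
  sortPair true  true  g₀ g₁ = g₀ ∨ g₁
  sortPair false false g₀ g₁ = g₀ ∨ g₁
  sortPair false true  g₀ g₁ = g₀ ∧ g₁

  sortPair-sorted : (b g₀ g₁ : Bool) → sortPair b false g₀ g₁ ≤[ b ] sortPair b true g₀ g₁
  sortPair-sorted true  = ∧≤∨
  sortPair-sorted false = ∧≤∨

  sortPair-mono : (t b c : Bool) {u u′ v v′ : Bool} → u ≤[ t ] u′ → v ≤[ t ] v′ →
                  sortPair b c u v ≤[ t ] sortPair b c u′ v′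
  sortPair-mono t true  false = ∧-mono-≤[ t ]
  sortPair-mono t true  true  = ∨-mono-≤[ t ]
  sortPair-mono t false false = ∨-mono-≤[ t ]
  sortPair-mono t false true  = ∧-mono-≤[ t ]

  ≤-by-computation : {m n : ℕ} {m≤n : True (m ≤? n)} → m ℕ.≤ n
  ≤-by-computation {m≤n = m≤n} = toWitness m≤n

  sortPair-distance : (b u v g₀ g₁ : Bool) →
    indicator (u xor sortPair b false g₀ g₁) + indicator (v xor sortPair b true g₀ g₁)
      ℕ.≤ indicator (u xor g₀) + indicator (v xor g₁) + 2 * indicator (edgeOfType (not b) u v)
  sortPair-distance false false false false false = ≤-by-computation
  sortPair-distance false false false false true  = ≤-by-computation
  sortPair-distance false false false true  false = ≤-by-computation
  sortPair-distance false false false true  true  = ≤-by-computation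
  sortPair-distance false false true  false false = ≤-by-computation
  sortPair-distance false false true  false true  = ≤-by-computation
  sortPair-distance false false true  true  false = ≤-by-computation
  sortPair-distance false false true  true  true  = ≤-by-computation
  sortPair-distance false true  false false false = ≤-by-computation
  sortPair-distance false true  false false true  = ≤-by-computation
  sortPair-distance false true  false true  false = ≤-by-computation
  sortPair-distance false true  false true  true  = ≤-by-computation
  sortPair-distance false true  true  false false = ≤-by-computation
  sortPair-distance false true  true  false true  = ≤-by-computation
  sortPair-distance false true  true  true  false = ≤-by-computation
  sortPair-distance false true  true  true  true  = ≤-by-computation
  sortPair-distance true  false false false false = ≤-by-computation
  sortPair-distance true  false false false true  = ≤-by-computation
  sortPair-distance true  false false true  false = ≤-by-computation
  sortPair-distance true  false false true  true  = ≤-by-computation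
  sortPair-distance true  false true  false false = ≤-by-computation
  sortPair-distance true  false true  false true  = ≤-by-computation
  sortPair-distance true  false true  true  false = ≤-by-computation
  sortPair-distance true  false true  true  true  = ≤-by-computation
  sortPair-distance true  true  false false false = ≤-by-computation
  sortPair-distance true  true  false false true  = ≤-by-computation
  sortPair-distance true  true  false true  false = ≤-by-computation
  sortPair-distance true  true  false true  true  = ≤-by-computation
  sortPair-distance true  true  true  false false = ≤-by-computation
  sortPair-distance true  true  true  false true  = ≤-by-computation
  sortPair-distance true  true  true  true  false = ≤-by-computation
  sortPair-distance true  true  true  true  true  = ≤-by-computation

  sortFaces : {n : ℕ} → Bool → (Cube n → Bool) → (Cube n → Bool) → Cube (suc n) → Bool
  sortFaces b g₀ g₁ (c ∷ y) = sortPair b c (g₀ y) (g₁ y)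

  sortFaces-monotone : {n : ℕ} (b : Bool) (d : Vec Bool n) (g₀ g₁ : Cube n → Bool) →
    MonotoneAlong d g₀ → MonotoneAlong d g₁ → MonotoneAlong (b ∷ d) (sortFaces b g₀ g₁)
  sortFaces-monotone b d g₀ g₁ mono₀ mono₁ zero    (false ∷ y) refl = sortPair-sorted b (g₀ y) (g₁ y)
  sortFaces-monotone b d g₀ g₁ mono₀ mono₁ (suc i) (c ∷ y)     yᵢ≡0 =
    sortPair-mono (lookup d i) b c (mono₀ i y yᵢ≡0) (mono₁ i y yᵢ≡0)

  symDiff-sortFaces : {n : ℕ} (b : Bool) (f : Cube (suc n) → Bool) (g₀ g₁ : Cube n → Bool) →
    symDiff f (sortFaces b g₀ g₁)
      ℕ.≤ symDiff (face f false) g₀ + symDiff (face f true) g₁ + 2 * edgeCount (not b) f zero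
  symDiff-sortFaces {n} b f g₀ g₁ = begin
    symDiff f (sortFaces b g₀ g₁)
      ≡⟨ symDiff-faces f (sortFaces b g₀ g₁) ⟩
    count (λ y → f₀ y xor sorted false y) P + count (λ y → f₁ y xor sorted true y) P
      ≡⟨ cong₂ _+_ (count≡sum-indicator _ P) (count≡sum-indicator _ P) ⟩
    Σ (λ y → indicator (f₀ y xor sorted false y)) + Σ (λ y → indicator (f₁ y xor sorted true y))
      ≡⟨ sum-map-+ _ _ P ⟨
    Σ (λ y → indicator (f₀ y xor sorted false y) + indicator (f₁ y xor sorted true y))
      ≤⟨ sum-map-mono (λ y → sortPair-distance b (f₀ y) (f₁ y) (g₀ y) (g₁ y)) P ⟩
    Σ (λ y → indicator (f₀ y xor g₀ y) + indicator (f₁ y xor g₁ y) + 2 * indicator (edge y))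
      ≡⟨ sum-map-+ _ _ P ⟩
    Σ (λ y → indicator (f₀ y xor g₀ y) + indicator (f₁ y xor g₁ y)) + Σ (λ y → 2 * indicator (edge y))
      ≡⟨ cong₂ _+_ (sum-map-+ _ _ P) (sum-map-*ˡ 2 _ P) ⟩
    Σ (λ y → indicator (f₀ y xor g₀ y)) + Σ (λ y → indicator (f₁ y xor g₁ y)) + 2 * Σ (indicator ∘ edge)
      ≡⟨ cong₂ _+_ (cong₂ _+_ (count≡sum-indicator _ P) (count≡sum-indicator _ P))
                   (cong (2 *_) (trans (edgeCount-zero (not b) f) (count≡sum-indicator edge P))) ⟨
    symDiff f₀ g₀ + symDiff f₁ g₁ + 2 * edgeCount (not b) f zero ∎
    where
    open ℕP.≤-Reasoning
    P : List (Cube n)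
    P = allPoints n
    f₀ f₁ : Cube n → Bool
    f₀ = face f false
    f₁ = face f true
    sorted : Bool → Cube n → Bool
    sorted c y = sortPair b c (g₀ y) (g₁ y)
    edge : Cube n → Bool
    edge y = edgeOfType (not b) (f₀ y) (f₁ y)
    Σ : (Cube n → ℕ) → ℕ
    Σ h = sum (map h P)

  sortAlong : {n : ℕ} → Vec Bool n → (Cube n → Bool) → Cube n → Bool
  sortAlong []      f = f
  sortAlong (b ∷ d) f = sortFaces b (sortAlong d (face f false)) (sortAlong d (face f true))

  sortAlong-monotone : {n : ℕ} (d : Vec Bool n) (f : Cube n → Bool) → MonotoneAlong d (sortAlong d f)
  sortAlong-monotone []      f ()
  sortAlong-monotone (b ∷ d) f = sortFaces-monotone b d _ _
    (sortAlong-monotone d (face f false)) (sortAlong-monotone d (face f true))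

  symDiff-self : {n : ℕ} (f : Cube n → Bool) → symDiff f f ≡ 0
  symDiff-self {n} f = trans (count-cong (λ x → BoolP.xor-same (f x)) (allPoints n))
                             (count-const-false (allPoints n))

  symDiff-sortAlong : {n : ℕ} (d : Vec Bool n) (f : Cube n → Bool) →
                      symDiff f (sortAlong d f) ℕ.≤ 2 * edgeSumAgainst f d
  symDiff-sortAlong []      f = ℕP.≤-reflexive (symDiff-self f)
  symDiff-sortAlong (b ∷ d) f = begin
    symDiff f (sortAlong (b ∷ d) f)
      ≤⟨ symDiff-sortFaces b f (sortAlong d (face f false)) (sortAlong d (face f true)) ⟩
    symDiff (face f false) _ + symDiff (face f true) _ + 2 * E
      ≤⟨ ℕP.+-monoˡ-≤ (2 * E) (+-mono-≤ (symDiff-sortAlong d (face f false))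
                                         (symDiff-sortAlong d (face f true))) ⟩
    2 * S₀ + 2 * S₁ + 2 * E
      ≡⟨ trans (ℕP.*-distribˡ-+ 2 (S₀ + S₁) E) (cong (_+ 2 * E) (ℕP.*-distribˡ-+ 2 S₀ S₁)) ⟨
    2 * (S₀ + S₁ + E)
      ≡⟨ cong (2 *_) (trans (+-comm (S₀ + S₁) E) (sym (edgeSumAgainst-∷ f b d))) ⟩
    2 * edgeSumAgainst f (b ∷ d) ∎
    where
    open ℕP.≤-Reasoning
    E S₀ S₁ : ℕ
    E  = edgeCount (not b) f zero
    S₀ = edgeSumAgainst (face f false) d
    S₁ = edgeSumAgainst (face f true) d

open Sorting using (sortAlong; sortAlong-monotone; symDiff-sortAlong; MonotoneAlong⇒Unate)

open import Data.Bool using (Bool)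
open import Data.Nat using (ℕ; _≤_)
open import Data.Vec using (Vec)
open import Data.Integer using (+_)
open import Data.Rational using (ℚ; _<_; _*_; _/_; toℚᵘ)
open import Data.Rational using () renaming (_≤_ to _≤ℚ_)
import Data.Rational as ℚ
import Data.Nat as ℕ
import Data.Nat.Properties as ℕP
import Data.Integer as ℤ
import Data.Integer.Properties as ℤP
import Data.Rational.Properties as ℚP
open import Data.Rational.Unnormalised as ℚᵘ using (mkℚᵘ; *≤*)
import Data.Rational.Unnormalised.Properties as ℚᵘP
open import Data.Nat.Tactic.RingSolver using (solve-∀)
open import Relation.Binary.PropositionalEquality using (_≡_; cong; trans; subst; subst₂)

-- + a / suc m is by definition fromℚᵘ (mkℚᵘ (+ a) m).
S/N*N/8≤E : (N S E : ℕ) .{{_ : ℕ.NonZero N}} → S ≤ 8 ℕ.* E → (+ S / N) * (+ N / 8) ≤ℚ + E / 1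
S/N*N/8≤E N@(ℕ.suc m) S E S≤8E = ℚP.toℚᵘ-cancel-≤ (begin
  toℚᵘ ((+ S / N) * (+ N / 8))        ≃⟨ ℚP.toℚᵘ-homo-* (+ S / N) (+ N / 8) ⟩
  toℚᵘ (+ S / N) ℚᵘ.* toℚᵘ (+ N / 8)  ≃⟨ ℚᵘP.*-cong (ℚP.toℚᵘ-fromℚᵘ (mkℚᵘ (+ S) m))
                                                   (ℚP.toℚᵘ-fromℚᵘ (mkℚᵘ (+ N) 7)) ⟩
  mkℚᵘ (+ S) m ℚᵘ.* mkℚᵘ (+ N) 7     ≤⟨ *≤* (subst₂ ℤ._≤_ numerator denominator (ℤ.+≤+ cross)) ⟩
  mkℚᵘ (+ E) 0                       ≃⟨ ℚP.toℚᵘ-fromℚᵘ (mkℚᵘ (+ E) 0) ⟨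
  toℚᵘ (+ E / 1) ∎)
  where
  open ℚᵘP.≤-Reasoning
  numerator : + (S ℕ.* N ℕ.* 1) ≡ + S ℤ.* + N ℤ.* + 1
  numerator = trans (ℤP.pos-* (S ℕ.* N) 1) (cong (ℤ._* + 1) (ℤP.pos-* S N))
  denominator : + (E ℕ.* (N ℕ.* 8)) ≡ + E ℤ.* + (N ℕ.* 8)
  denominator = ℤP.pos-* E (N ℕ.* 8)
  reorder : ∀ e k → 8 ℕ.* e ℕ.* k ≡ e ℕ.* (k ℕ.* 8)
  reorder = solve-∀
  cross : S ℕ.* N ℕ.* 1 ≤ E ℕ.* (N ℕ.* 8)
  cross = ℕP.≤-trans (ℕP.≤-reflexive (ℕP.*-identityʳ (S ℕ.* N)))
            (subst (S ℕ.* N ≤_) (reorder E N) (ℕP.*-monoˡ-≤ N S≤8E))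

scaled-lower-bound : (N S E : ℕ) .{{_ : ℕ.NonZero N}} (ε : ℚ) →
  ε < + S / N → S ≤ 8 ℕ.* E → ε * (+ N / 8) ≤ℚ + E / 1
scaled-lower-bound N S E ε ε<S/N S≤8E = begin
  ε * (+ N / 8)         ≤⟨ ℚP.*-monoʳ-≤-nonNeg (+ N / 8) (ℚP.<⇒≤ ε<S/N) ⟩
  (+ S / N) * (+ N / 8) ≤⟨ S/N*N/8≤E N S E S≤8E ⟩
  + E / 1 ∎
  where
  open ℚP.≤-Reasoning
  instance
    N/8≥0 : ℚ.NonNegative (+ N / 8)
    N/8≥0 = ℚP.normalize-nonNeg N 8

corollary3p7 : (n : ℕ) (f : Cube n → Bool) (hN : 1 ≤ ones f) (ε : ℚ) →
    ((g : Cube n → Bool) → Unate g → ε < reldist f g hN) →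
    (d : Vec Bool n) →
    ε * ((+ ones f) / 8) ≤ℚ ((+ edgeSumAgainst f d) / 1)
corollary3p7 n f hN ε far d =
  scaled-lower-bound (ones f) (symDiff f g) (edgeSumAgainst f d) ε
    (far g (MonotoneAlong⇒Unate d g (sortAlong-monotone d f)))
    (ℕP.≤-trans (symDiff-sortAlong d f) (ℕP.*-monoˡ-≤ (edgeSumAgainst f d) 2≤8))
  where
  instance
    N≢0 : ℕ.NonZero (ones f)
    N≢0 = ℕ.>-nonZero hN
  g : Cube n → Bool
  g = sortAlong d f
  2≤8 : 2 ≤ 8
  2≤8 = ℕ.s≤s (ℕ.s≤s ℕ.z≤n)
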